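{- Every pseudo-Boolean poset, and hence also every Boolean poset, is pseudo-orthomodular.
   Context: For a poset $(P,\leq)$ and $A\subseteq P$ let $L(A)=\{x\in P\mid x\leq y\text{ for all }y\in A\}$ and $U(A)=\{x\in P\mid y\leq x\text{ for all }y\in A\}$; we write $L(a,b)$ for $L(\{a,b\})$, $L(A,a)$ for $L(A\cup\{a\})$, $L(A,B)$ for $L(A\cup B)$, etc., and similarly for $U$. A poset with complementation is $(P,\leq,{}',0,1)$ with $(P,\leq,0,1)$ a bounded poset and $'$ a unary operation such that $L(x,x')=\{0\}$, $U(x,x')=\{1\}$, $x\leq y$ implies $y'\leq x'$, and $(x')'=x$. A pseudo-orthomodular poset is a poset with complementation satisfying $L(U(L(x,y),y'),y)=L(x,y)$ for all $x,y$ (equivalently $U(L(U(x,y),y'),y)=U(x,y)$). A pseudo-Boolean poset is a poset with complementation satisfying $L(U(x,y),y')=L(x,y')$ for all $x,y$ (equivalently $U(L(x,y),y')=U(x,y')$). A poset is distributive if $L(U(x,y),z)=L(U(L(x,z),L(y,z)))$ for all $x,y,z$; a Boolean poset is a distributive poset with complementation. -}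

module Defs where

open import Level using (Level; _⊔_)
open import Data.Sum using (_⊎_)
open import Data.Product using (_×_)
open import Relation.Unary using (Pred; _∪_; _≐_)
open import Relation.Binary.Bundles using (Poset)

module PosetNotions {c ℓ₁ ℓ₂ : Level} (P : Poset c ℓ₁ ℓ₂) where
  open Poset P public using (Carrier; _≈_; _≤_)

  ⟦_⟧ : Carrier → Pred Carrier ℓ₁
  ⟦ a ⟧ z = z ≈ a

  ⟦_,_⟧ : Carrier → Carrier → Pred Carrier ℓ₁
  ⟦ a , b ⟧ z = (z ≈ a) ⊎ (z ≈ b)

  L : {ℓ : Level} → Pred Carrier ℓ → Pred Carrier (c ⊔ ℓ ⊔ ℓ₂)
  L A x = ∀ y → A y → x ≤ y

  U : {ℓ : Level} → Pred Carrier ℓ → Pred Carrier (c ⊔ ℓ ⊔ ℓ₂)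
  U A x = ∀ y → A y → y ≤ x

record PosetWithComplementation (c ℓ₁ ℓ₂ : Level) : Set (Level.suc (c ⊔ ℓ₁ ⊔ ℓ₂)) where
  field
    poset : Poset c ℓ₁ ℓ₂
  open PosetNotions poset public
  field
    𝟘 𝟙     : Carrier
    bottom  : ∀ x → 𝟘 ≤ x
    top     : ∀ x → x ≤ 𝟙
    _′      : Carrier → Carrier
    L-compl : ∀ x → L ⟦ x , x ′ ⟧ ≐ ⟦ 𝟘 ⟧
    U-compl : ∀ x → U ⟦ x , x ′ ⟧ ≐ ⟦ 𝟙 ⟧
    antitone : ∀ {x y} → x ≤ y → (y ′) ≤ (x ′)
    involutive : ∀ x → ((x ′) ′) ≈ x

module _ {c ℓ₁ ℓ₂ : Level} (P : PosetWithComplementation c ℓ₁ ℓ₂) where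
  open PosetWithComplementation P

  IsPseudoOrthomodular : Set _
  IsPseudoOrthomodular =
    ∀ x y → L (U (L ⟦ x , y ⟧ ∪ ⟦ y ′ ⟧) ∪ ⟦ y ⟧) ≐ L ⟦ x , y ⟧

  IsPseudoBoolean : Set _
  IsPseudoBoolean = ∀ x y → L (U ⟦ x , y ⟧ ∪ ⟦ y ′ ⟧) ≐ L ⟦ x , y ′ ⟧

  IsDistributive : Set _
  IsDistributive = ∀ x y z →
    L (U ⟦ x , y ⟧ ∪ ⟦ z ⟧) ≐ L (U (L ⟦ x , z ⟧ ∪ L ⟦ y , z ⟧))

  -- a Boolean poset is a distributive poset with complementation
  IsBooleanPoset : Set _
  IsBooleanPoset = IsDistributive

module Submission where

-- Both claims pass through one intermediate property of a poset with
-- complementation, here called having the *complement-absorption law*: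
--
--     every common lower bound of U(x,y) and y' lies below x.
--
-- (1) A pseudo-Boolean poset has it: L(U(x,y),y') = L(x,y') ⊆ L(x).
-- (2) A Boolean (distributive) poset has it: L(U(x,y),y') = L(U(L(x,y'),L(y,y')))
--     and L(y,y') = {0}, so x is an upper bound of L(x,y') ∪ L(y,y').
-- (3) The law implies pseudo-orthomodularity: if z ∈ L(U(L(x,y),y'),y) then
--     z ≤ y = y'' and U(x,y') ⊆ U(L(x,y),y'), so z ∈ L(U(x,y'),y''), and the law
--     applied to (x, y') gives z ≤ x.  The other inclusion holds in any poset.

open import Defs
open import Level using (Level)
open import Data.Product as Product using (_×_; proj₁)
open import Data.Sum using (inj₁; inj₂)
open import Relation.Unary using (Pred; _∪_; _⊆_)
open import Relation.Binary.Bundles using (Poset)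

module Cones {c ℓ₁ ℓ₂ : Level} (P : Poset c ℓ₁ ℓ₂) where
  open PosetNotions P
  open Poset P using (module Eq; ≤-respʳ-≈; ≤-respˡ-≈)

  L-antitone : {ℓ ℓ′ : Level} {A : Pred Carrier ℓ} {B : Pred Carrier ℓ′} →
               A ⊆ B → L B ⊆ L A
  L-antitone A⊆B zB y yA = zB y (A⊆B yA)

  L-singleton : ∀ {z a} → z ≤ a → L ⟦ a ⟧ z
  L-singleton z≤a y y≈a = ≤-respʳ-≈ (Eq.sym y≈a) z≤a

  U-singleton : ∀ {z a} → a ≤ z → U ⟦ a ⟧ z
  U-singleton a≤z y y≈a = ≤-respˡ-≈ (Eq.sym y≈a) a≤z

  L-pair : ∀ {z a b} → z ≤ a → z ≤ b → L ⟦ a , b ⟧ z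
  L-pair z≤a z≤b y (inj₁ y≈a) = L-singleton z≤a y y≈a
  L-pair z≤a z≤b y (inj₂ y≈b) = L-singleton z≤b y y≈b

  below-left : ∀ {z a b} → L ⟦ a , b ⟧ z → z ≤ a
  below-left zL = zL _ (inj₁ Eq.refl)

  above-left : ∀ {z a b} → U ⟦ a , b ⟧ z → a ≤ z
  above-left zU = zU _ (inj₁ Eq.refl)

  above-right : ∀ {z a b} → U ⟦ a , b ⟧ z → b ≤ z
  above-right zU = zU _ (inj₂ Eq.refl)

module _ {c ℓ₁ ℓ₂ : Level} (P : PosetWithComplementation c ℓ₁ ℓ₂) where
  open PosetWithComplementation P
  open Poset poset using (trans; reflexive; module Eq)
  open Cones poset

  ComplementAbsorption : Set _
  ComplementAbsorption = ∀ x y {z} → L (U ⟦ x , y ⟧ ∪ ⟦ y ′ ⟧) z → z ≤ x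

  pseudoBoolean⇒absorption : IsPseudoBoolean P → ComplementAbsorption
  pseudoBoolean⇒absorption pb x y zL = below-left (proj₁ (pb x y) zL)

  distributive⇒absorption : IsDistributive P → ComplementAbsorption
  distributive⇒absorption dist x y zL = proj₁ (dist x y (y ′)) zL x x-bounds
    where
      x-bounds : U (L ⟦ x , y ′ ⟧ ∪ L ⟦ y , y ′ ⟧) x
      x-bounds v (inj₁ v∈L[x,y′]) = below-left v∈L[x,y′]
      x-bounds v (inj₂ v∈L[y,y′]) =
        trans (reflexive (proj₁ (L-compl y) v∈L[y,y′])) (bottom x)

  U[x,y′]⊆U[L[x,y],y′] : ∀ x y → U ⟦ x , y ′ ⟧ ⊆ U (L ⟦ x , y ⟧ ∪ ⟦ y ′ ⟧)
  U[x,y′]⊆U[L[x,y],y′] x y wU v (inj₁ v∈L[x,y]) = trans (below-left v∈L[x,y]) (above-left wU)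
  U[x,y′]⊆U[L[x,y],y′] x y wU v (inj₂ v≈y′) = U-singleton (above-right wU) v v≈y′

  absorption⇒pseudoOrthomodular : ComplementAbsorption → IsPseudoOrthomodular P
  absorption⇒pseudoOrthomodular absorb x y = Product._,_ shrink grow
    where
      shrink : L (U (L ⟦ x , y ⟧ ∪ ⟦ y ′ ⟧) ∪ ⟦ y ⟧) ⊆ L ⟦ x , y ⟧
      shrink {z} zL = L-pair (absorb x (y ′) z∈L[U[x,y′],y″]) z≤y
        where
          z≤y : z ≤ y
          z≤y = zL y (inj₂ Eq.refl)
          z∈L[U[x,y′],y″] : L (U ⟦ x , y ′ ⟧ ∪ ⟦ (y ′) ′ ⟧) z
          z∈L[U[x,y′],y″] =
            L-antitone (λ { (inj₁ wU) → inj₁ (U[x,y′]⊆U[L[x,y],y′] x y wU)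
                          ; (inj₂ w≈y″) → inj₂ (Eq.trans w≈y″ (involutive y)) })
                       zL

      grow : L ⟦ x , y ⟧ ⊆ L (U (L ⟦ x , y ⟧ ∪ ⟦ y ′ ⟧) ∪ ⟦ y ⟧)
      grow zL w (inj₁ wU) = wU _ (inj₁ zL)
      grow zL w (inj₂ w≈y) = zL w (inj₂ w≈y)

lemma3 : {c ℓ₁ ℓ₂ : Level} (P : PosetWithComplementation c ℓ₁ ℓ₂) →
    (IsPseudoBoolean P → IsPseudoOrthomodular P) ×
    (IsBooleanPoset P → IsPseudoOrthomodular P)
lemma3 P = Product._,_
  (λ pb → absorption⇒pseudoOrthomodular P (pseudoBoolean⇒absorption P pb))
  (λ bool → absorption⇒pseudoOrthomodular P (distributive⇒absorption P bool))
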